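{- Let $G=(V,E)$ be a tree. Then \[ P_T(G)=\Big\{(x,y)\in\mathbb{R}^{V}\times\mathbb{R}^{E} \;:\; x_v+\sum_{e\in\delta(v)}y_e\le 1\ \ \forall v\in V,\quad x_v+x_w+y_e\le 1\ \ \forall e=\{v,w\}\in E,\quad x_v\ge 0\ \forall v\in V,\ y_e\ge 0\ \forall e\in E\Big\}. \]
   Context: All graphs are finite, simple, loopless and undirected. For $G=(V,E)$, two elements of $V\cup E$ are adjacent if they are adjacent vertices, incident (sharing an endpoint) edges, or an edge and one of its endpoints; otherwise they are independent. A total matching is a subset $T\subseteq V\cup E$ of pairwise independent elements. The Total Matching Polytope $P_T(G)\subseteq\mathbb{R}^{|V|+|E|}$ is the convex hull of the characteristic vectors $\chi[T]=(x,y)$ of all total matchings $T$, where $x\in\{0,1\}^V$ are the vertex coordinates, $y\in\{0,1\}^E$ the edge coordinates, and a coordinate equals $1$ iff the corresponding element lies in $T$. $\delta(v)$ denotes the set of edges incident to $v$.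
   Formalization: The points (x,y) have rational coordinates rather than real ones, and the convex hull defining $P_T(G)$ uses rational coefficients for the characteristic vectors of total matchings. -}

module Defs where

open import Data.Nat using (ℕ; zero; suc)
open import Data.Fin using (Fin; zero; suc; inject₁; fromℕ; _≟_)
open import Data.Bool using (Bool; true; false; if_then_else_; _∨_; T)
open import Data.Product using (_×_; _,_; proj₁; proj₂; Σ; ∃; ∃-syntax)
open import Data.Sum using (_⊎_)
open import Data.Empty using (⊥)
open import Relation.Nullary using (¬_)
open import Relation.Nullary.Decidable using (⌊_⌋)
open import Relation.Binary.PropositionalEquality using (_≡_; _≢_)
open import Data.Rational using (ℚ; 0ℚ; 1ℚ; _+_; _*_; _≤_)

-- A finite graph on vertex set Fin n with edge set Fin m; edge e has
-- endpoints ends e = (u , v) (the order is irrelevant, edges are undirected).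
Ends : ℕ → ℕ → Set
Ends n m = Fin m → Fin n × Fin n

Joins : ∀ {n m} → Ends n m → Fin m → Fin n → Fin n → Set
Joins ends e u v = (ends e ≡ (u , v)) ⊎ (ends e ≡ (v , u))

IsSimple : ∀ {n m} → Ends n m → Set
IsSimple {n} {m} ends =
  (∀ (e : Fin m) → proj₁ (ends e) ≢ proj₂ (ends e)) ×
  (∀ (e f : Fin m) → Joins ends f (proj₁ (ends e)) (proj₂ (ends e)) → e ≡ f)

Adj : ∀ {n m} → Ends n m → Fin n → Fin n → Set
Adj ends u v = ∃[ e ] Joins ends e u v

Incident : ∀ {n m} → Ends n m → Fin n → Fin m → Set
Incident ends v e = (proj₁ (ends e) ≡ v) ⊎ (proj₂ (ends e) ≡ v)

incident? : ∀ {n m} → Ends n m → Fin n → Fin m → Bool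
incident? ends v e = ⌊ proj₁ (ends e) ≟ v ⌋ ∨ ⌊ proj₂ (ends e) ≟ v ⌋

data Walk {n m} (ends : Ends n m) : Fin n → Fin n → Set where
  here : ∀ {u} → Walk ends u u
  step : ∀ {u v w} → Adj ends u v → Walk ends v w → Walk ends u w

Connected : ∀ {n m} → Ends n m → Set
Connected {n} ends = ∀ (u v : Fin n) → Walk ends u v

Injective : ∀ {k n} → (Fin k → Fin n) → Set
Injective {k} c = ∀ (i j : Fin k) → c i ≡ c j → i ≡ j

-- a cycle: distinct vertices c 0, …, c (k+2) (length ≥ 3), consecutive ones
-- adjacent and the last adjacent to the first
IsCycle : ∀ {n m} → Ends n m → (k : ℕ) → (Fin (suc (suc (suc k))) → Fin n) → Set
IsCycle ends k c =
  Injective c ×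
  (∀ (i : Fin (suc (suc k))) → Adj ends (c (inject₁ i)) (c (suc i))) ×
  Adj ends (c (fromℕ (suc (suc k)))) (c zero)

Acyclic : ∀ {n m} → Ends n m → Set
Acyclic {n} ends = ∀ (k : ℕ) (c : Fin (suc (suc (suc k))) → Fin n) → ¬ IsCycle ends k c

IsTree : ∀ {n m} → Ends n m → Set
IsTree ends = Connected ends × Acyclic ends

IsTotalMatching : ∀ {n m} → Ends n m → (Fin n → Bool) → (Fin m → Bool) → Set
IsTotalMatching {n} {m} ends a b =
  (∀ (u v : Fin n) → T (a u) → T (a v) → ¬ Adj ends u v) ×
  (∀ (e f : Fin m) → T (b e) → T (b f) → e ≢ f →
     ∀ (v : Fin n) → Incident ends v e → ¬ Incident ends v f) ×
  (∀ (v : Fin n) (e : Fin m) → T (a v) → T (b e) → ¬ Incident ends v e)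

χ : Bool → ℚ
χ b = if b then 1ℚ else 0ℚ

Σ[_] : ∀ {k} → (Fin k → ℚ) → ℚ
Σ[_] {zero} f = 0ℚ
Σ[_] {suc k} f = f zero + Σ[_] (λ i → f (suc i))

InPT : ∀ {n m} → Ends n m → (Fin n → ℚ) → (Fin m → ℚ) → Set
InPT {n} {m} ends x y =
  Σ ℕ λ k → Σ (Fin k → ℚ) λ λs → Σ (Fin k → Fin n → Bool) λ a → Σ (Fin k → Fin m → Bool) λ b →
    (∀ i → IsTotalMatching ends (a i) (b i)) ×
    (∀ i → 0ℚ ≤ λs i) ×
    (Σ[ λs ] ≡ 1ℚ) ×
    (∀ v → x v ≡ Σ[ (λ i → λs i * χ (a i v)) ]) ×
    (∀ e → y e ≡ Σ[ (λ i → λs i * χ (b i e)) ])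

InQ : ∀ {n m} → Ends n m → (Fin n → ℚ) → (Fin m → ℚ) → Set
InQ {n} {m} ends x y =
  (∀ (v : Fin n) → x v + Σ[ (λ e → if incident? ends v e then y e else 0ℚ) ] ≤ 1ℚ) ×
  (∀ (e : Fin m) → x (proj₁ (ends e)) + x (proj₂ (ends e)) + y e ≤ 1ℚ) ×
  (∀ (v : Fin n) → 0ℚ ≤ x v) ×
  (∀ (e : Fin m) → 0ℚ ≤ y e)

-- PT ⊆ Q holds for every graph: at a vertex v the elements v and δ(v), and on an edge
-- e = {v, w} the elements v, w and e, are pairwise adjacent, so a total matching contains
-- at most one of them, and the inequalities survive convex combinations.
--
-- Q ⊆ PT: clearing denominators turns a point of Q into natural numbers X, Y and D with
-- X v + Σ_{e ∈ δ(v)} Y e ≤ D and X v + X w + Y e ≤ D.  On a forest these are realised by a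
-- total colouring with D colours in which v receives X v colours and e receives Y e colours,
-- adjacent elements receiving disjoint sets; every colour class is then a total matching and
-- (x, y) is the average of the D classes.  The colouring is built by adding one edge e₀ = pq
-- at a time.  As the forest has no cycle, p and q lie in different components of the rest.
-- The colours S of e₀ are chosen among those unused at p, and q's component is recoloured
-- so that q avoids S and the colours of p, and the edges at q avoid S.  Hence the induction
-- hypothesis allows forbidden colour sets for one root vertex and for the edges at it.

module Submission where

open import Defs
open import Data.Nat using (ℕ)
open import Data.Fin using (Fin)
open import Data.Rational using (ℚ)
open import Data.Product using (_×_)

open import Algebra.Bundles using (CommutativeRing)
open import Data.Bool using (Bool; true; false; if_then_else_; T; _∧_)
open import Data.Bool.Properties using (T-∨; T-∧; T-≡)
open import Data.Empty using (⊥; ⊥-elim)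
open import Data.Fin as Fin using (zero; suc)
open import Data.Fin.Properties using (suc-injective)
open import Data.Fin.Subset as Sub
  using (Subset; _⊆_; _∪_; ∁; ∣_∣; inside; outside) renaming (⊥ to ∅)
open import Data.Fin.Subset.Properties using
  ( ⊆-trans; p⊆p∪q; q⊆p∪q; p⊆q⇒∁p⊇∁q; x∉p⇒x∈∁p; x∈∁p⇒x∉p
  ; ∣p∣≤∣x∷p∣; out⊆; s⊆s; ⊥⊆; ∣⊥∣≡0; ∣∁p∣≡n∸∣p∣ )
open import Data.Integer as ℤ using ()
import Data.Integer.Properties as ℤP
open import Data.Nat as ℕ using (zero; suc)
import Data.Nat.Properties as ℕP
open import Data.Nat.Tactic.RingSolver using (solve-∀)
open import Data.Product using (_,_; proj₁; proj₂; Σ; Σ-syntax)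
open import Data.Rational as ℚ using (0ℚ; 1ℚ; _+_; _*_; _≤_; 1/_; ↥_; ↧ₙ_)
open import Data.Rational.Literals using (fromℤ)
import Data.Rational.Properties as ℚP
import Data.Rational.Unnormalised as ℚᵘ
import Data.Rational.Unnormalised.Properties as ℚᵘP
open import Data.Sum as Sum using (_⊎_; inj₁; inj₂)
open import Data.Unit using (⊤; tt)
open import Data.Vec using ([]; _∷_; lookup)
open import Data.Vec.Functional using (tail; foldr)
open import Data.Vec.Properties using (lookup⇒[]=)
open import Function using (_∘_; Equivalence)
open import Relation.Binary.PropositionalEquality
open import Relation.Nullary using (¬_; Dec; yes; no)
open import Relation.Nullary.Decidable using (⌊_⌋; _⊎-dec_; toWitness; fromWitness)

open import Algebra.Properties.Semiring.Sum (CommutativeRing.semiring ℚP.+-*-commutativeRing)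
  using (sum; sum-cong-≗; ∑-distrib-+; ∑-comm; *-distribˡ-sum; *-distribʳ-sum; sum-replicate-zero)
open import Algebra.Properties.CommutativeMonoid.Sum ℕP.+-0-commutativeMonoid
  using () renaming (sum to sumℕ; sum-cong-≗ to sumℕ-cong-≗)
open import Algebra.Properties.CommutativeSemigroup ℕP.+-commutativeSemigroup
  using (xy∙z≈xz∙y; xy∙z≈y∙xz)

-- Rationals and finite sums

fromℕ : ℕ → ℚ
fromℕ n = fromℤ (ℤ.+ n)

fromℕ-+ : ∀ a b → fromℕ (a ℕ.+ b) ≡ fromℕ a + fromℕ b
fromℕ-+ a b = ℚP.toℚᵘ-injective
  (ℚᵘP.≃-sym (ℚᵘP.≃-trans (ℚP.toℚᵘ-homo-+ (fromℕ a) (fromℕ b)) (ℚᵘ.*≡* eq)))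
  where
  eq : (ℤ.+ a ℤ.* ℤ.+ 1 ℤ.+ ℤ.+ b ℤ.* ℤ.+ 1) ℤ.* ℤ.+ 1 ≡ ℤ.+ (a ℕ.+ b) ℤ.* ℤ.+ 1
  eq rewrite ℤP.*-identityʳ (ℤ.+ a) | ℤP.*-identityʳ (ℤ.+ b) = refl

fromℕ-* : ∀ a b → fromℕ (a ℕ.* b) ≡ fromℕ a * fromℕ b
fromℕ-* a b = ℚP.toℚᵘ-injective
  (ℚᵘP.≃-sym (ℚᵘP.≃-trans (ℚP.toℚᵘ-homo-* (fromℕ a) (fromℕ b)) (ℚᵘ.*≡* eq)))
  where
  eq : (ℤ.+ a ℤ.* ℤ.+ b) ℤ.* ℤ.+ 1 ≡ ℤ.+ (a ℕ.* b) ℤ.* ℤ.+ 1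
  eq = cong (ℤ._* ℤ.+ 1) (sym (ℤP.pos-* a b))

fromℕ-cancel-≤ : ∀ {a b} → fromℕ a ≤ fromℕ b → a ℕ.≤ b
fromℕ-cancel-≤ {a} {b} (ℚ.*≤* a≤b)
  with subst₂ ℤ._≤_ (ℤP.*-identityʳ (ℤ.+ a)) (ℤP.*-identityʳ (ℤ.+ b)) a≤b
... | ℤ.+≤+ a≤b = a≤b

*-denominator : ∀ q → 0ℚ ≤ q → q * fromℕ (↧ₙ q) ≡ fromℕ ℤ.∣ ↥ q ∣
*-denominator q@(ℚ.mkℚ (ℤ.+ k) d _) _ =
  ℚP.toℚᵘ-injective (ℚᵘP.≃-trans (ℚP.toℚᵘ-homo-* q (fromℕ (suc d))) (ℚᵘ.*≡* eq))
  where
  eq : (ℤ.+ k ℤ.* ℤ.+ suc d) ℤ.* ℤ.+ 1 ≡ ℤ.+ k ℤ.* ℤ.+ (suc d ℕ.* 1)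
  eq rewrite ℤP.*-identityʳ (ℤ.+ k ℤ.* ℤ.+ suc d) | ℕP.*-identityʳ d = refl
*-denominator (ℚ.mkℚ ℤ.-[1+ _ ] _ _) (ℚ.*≤* ())

fromℕ-sumℕ : ∀ {k} (G : Fin k → ℕ) → fromℕ (sumℕ G) ≡ sum (fromℕ ∘ G)
fromℕ-sumℕ {zero} G = refl
fromℕ-sumℕ {suc k} G =
  trans (fromℕ-+ (G zero) (sumℕ (G ∘ suc))) (cong (fromℕ (G zero) +_) (fromℕ-sumℕ (G ∘ suc)))

Σ≡sum : ∀ {k} (f : Fin k → ℚ) → Σ[ f ] ≡ sum f
Σ≡sum {zero} f = refl
Σ≡sum {suc k} f = cong (f zero +_) (Σ≡sum (f ∘ suc))

sum-mono-≤ : ∀ {k} {f g : Fin k → ℚ} → (∀ i → f i ≤ g i) → sum f ≤ sum g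
sum-mono-≤ {zero} f≤g = ℚP.≤-refl
sum-mono-≤ {suc k} f≤g = ℚP.+-mono-≤ (f≤g zero) (sum-mono-≤ (f≤g ∘ suc))

sum-const : ∀ k z → sum (λ (_ : Fin k) → z) ≡ fromℕ k * z
sum-const zero z = sym (ℚP.*-zeroˡ z)
sum-const (suc k) z = begin
  z + sum (λ (_ : Fin k) → z)   ≡⟨ cong₂ _+_ (ℚP.*-identityˡ z) (sym (sum-const k z)) ⟨
  1ℚ * z + fromℕ k * z         ≡⟨ ℚP.*-distribʳ-+ z 1ℚ (fromℕ k) ⟨
  (1ℚ + fromℕ k) * z           ≡⟨ cong (_* z) (fromℕ-+ 1 k) ⟨
  fromℕ (suc k) * z            ∎
  where open ≡-Reasoning

χ-nonneg : ∀ b → 0ℚ ≤ χ b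
χ-nonneg false = ℚP.≤-refl
χ-nonneg true = ℚP.≤ᵇ⇒≤ tt

sum-χ-≡-0 : ∀ {k} (B : Fin k → Bool) → (∀ i → ¬ T (B i)) → sum (χ ∘ B) ≡ 0ℚ
sum-χ-≡-0 {k} B none = trans (sum-cong-≗ χ≡0) (sum-replicate-zero k)
  where
  χ≡0 : ∀ i → χ (B i) ≡ 0ℚ
  χ≡0 i with B i | none i
  ... | false | _ = refl
  ... | true | ¬T = ⊥-elim (¬T tt)

sum-χ-≤-1 : ∀ {k} (B : Fin k → Bool) → (∀ i j → T (B i) → T (B j) → i ≡ j) →
  sum (χ ∘ B) ≤ 1ℚ
sum-χ-≤-1 {zero} B _ = ℚP.≤ᵇ⇒≤ tt
sum-χ-≤-1 {suc k} B unique with B zero in B₀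
... | true =
  ℚP.≤-reflexive (trans (cong (1ℚ +_) (sum-χ-≡-0 (B ∘ suc) rest-false)) (ℚP.+-identityʳ 1ℚ))
  where
  rest-false : ∀ i → ¬ T (B (suc i))
  rest-false i Bi with () ← unique zero (suc i) (subst T (sym B₀) tt) Bi
... | false = subst (_≤ 1ℚ) (sym (ℚP.+-identityˡ _))
                (sum-χ-≤-1 (B ∘ suc) (λ i j Bi Bj → suc-injective (unique (suc i) (suc j) Bi Bj)))

-- Total matchings satisfy the inequalities

module _ {n m} (ends : Ends n m) {v : Fin n} {e : Fin m} where

  incident?-sound : T (incident? ends v e) → Incident ends v e
  incident?-sound =
    Sum.map toWitness toWitness ∘ Equivalence.to (T-∨ {⌊ proj₁ (ends e) Fin.≟ v ⌋})

  incident?-complete : Incident ends v e → T (incident? ends v e)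
  incident?-complete =
    Equivalence.from (T-∨ {⌊ proj₁ (ends e) Fin.≟ v ⌋}) ∘ Sum.map fromWitness fromWitness

module _ {n m} (ends : Ends n m) {e : Fin m} {p q : Fin n} where

  Joins-incident : ∀ {v} → Joins ends e p q → Incident ends v e → v ≡ p ⊎ v ≡ q
  Joins-incident (inj₁ eq) (inj₁ v≡) = inj₁ (trans (sym v≡) (cong proj₁ eq))
  Joins-incident (inj₁ eq) (inj₂ v≡) = inj₂ (trans (sym v≡) (cong proj₂ eq))
  Joins-incident (inj₂ eq) (inj₁ v≡) = inj₂ (trans (sym v≡) (cong proj₁ eq))
  Joins-incident (inj₂ eq) (inj₂ v≡) = inj₁ (trans (sym v≡) (cong proj₂ eq))

  Joins-incidentˡ : Joins ends e p q → Incident ends p e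
  Joins-incidentˡ (inj₁ eq) = inj₁ (cong proj₁ eq)
  Joins-incidentˡ (inj₂ eq) = inj₂ (cong proj₂ eq)

  Joins-incidentʳ : Joins ends e p q → Incident ends q e
  Joins-incidentʳ (inj₁ eq) = inj₂ (cong proj₂ eq)
  Joins-incidentʳ (inj₂ eq) = inj₁ (cong proj₁ eq)

  module _ (R : Fin n → Fin n → Set) (R-sym : ∀ {u v} → R u v → R v u) where

    Joins-endpoints⁺ : Joins ends e p q → R p q → R (proj₁ (ends e)) (proj₂ (ends e))
    Joins-endpoints⁺ (inj₁ eq) Rpq = subst (λ uv → R (proj₁ uv) (proj₂ uv)) (sym eq) Rpq
    Joins-endpoints⁺ (inj₂ eq) Rpq = subst (λ uv → R (proj₁ uv) (proj₂ uv)) (sym eq) (R-sym Rpq)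

    Joins-endpoints⁻ : Joins ends e p q → R (proj₁ (ends e)) (proj₂ (ends e)) → R p q
    Joins-endpoints⁻ (inj₁ eq) R₁₂ = subst (λ uv → R (proj₁ uv) (proj₂ uv)) eq R₁₂
    Joins-endpoints⁻ (inj₂ eq) R₁₂ = R-sym (subst (λ uv → R (proj₁ uv) (proj₂ uv)) eq R₁₂)

vertexLoad : ∀ {n m} → Ends n m → (Fin n → ℚ) → (Fin m → ℚ) → Fin n → ℚ
vertexLoad ends x y v = x v + sum (λ e → if incident? ends v e then y e else 0ℚ)

edgeLoad : ∀ {n m} → Ends n m → (Fin n → ℚ) → (Fin m → ℚ) → Fin m → ℚ
edgeLoad ends x y e = x (proj₁ (ends e)) + x (proj₂ (ends e)) + y e

module _ {n m} {ends : Ends n m} {a : Fin n → Bool} {b : Fin m → Bool}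
         (tm : IsTotalMatching ends a b) where

  private
    vertex-vertex = proj₁ tm
    edge-edge = proj₁ (proj₂ tm)
    vertex-edge = proj₂ (proj₂ tm)

    ≡true⇒T : ∀ {x} → x ≡ true → T x
    ≡true⇒T = Equivalence.from T-≡

  vertexLoad-≤-1 : ∀ v → vertexLoad ends (χ ∘ a) (χ ∘ b) v ≤ 1ℚ
  vertexLoad-≤-1 v = subst (_≤ 1ℚ) (cong (χ (a v) +_) (sum-cong-≗ χ-∧)) (sum-χ-≤-1 chosen unique)
    where
    chosen : Fin (suc m) → Bool
    chosen zero = a v
    chosen (suc e) = incident? ends v e ∧ b e

    χ-∧ : ∀ e → χ (incident? ends v e ∧ b e) ≡ (if incident? ends v e then χ (b e) else 0ℚ)
    χ-∧ e with incident? ends v e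
    ... | true = refl
    ... | false = refl

    unique : ∀ i j → T (chosen i) → T (chosen j) → i ≡ j
    unique zero zero _ _ = refl
    unique zero (suc f) av vf with vf′ , bf ← Equivalence.to T-∧ vf =
      ⊥-elim (vertex-edge v f av bf (incident?-sound ends vf′))
    unique (suc e) zero ve av with ve′ , be ← Equivalence.to T-∧ ve =
      ⊥-elim (vertex-edge v e av be (incident?-sound ends ve′))
    unique (suc e) (suc f) ve vf with e Fin.≟ f
    ... | yes e≡f = cong suc e≡f
    ... | no e≢f with ve′ , be ← Equivalence.to T-∧ ve | vf′ , bf ← Equivalence.to T-∧ vf =
      ⊥-elim (edge-edge e f be bf e≢f v (incident?-sound ends ve′) (incident?-sound ends vf′))

  edgeLoad-≤-1 : ∀ e → edgeLoad ends (χ ∘ a) (χ ∘ b) e ≤ 1ℚ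
  edgeLoad-≤-1 e with a (proj₁ (ends e)) in ap | a (proj₂ (ends e)) in aq | b e in be
  ... | true  | true  | _     = ⊥-elim (vertex-vertex _ _ (≡true⇒T ap) (≡true⇒T aq) (e , inj₁ refl))
  ... | true  | false | true  = ⊥-elim (vertex-edge _ e (≡true⇒T ap) (≡true⇒T be) (inj₁ refl))
  ... | false | true  | true  = ⊥-elim (vertex-edge _ e (≡true⇒T aq) (≡true⇒T be) (inj₂ refl))
  ... | true  | false | false = ℚP.≤ᵇ⇒≤ tt
  ... | false | true  | false = ℚP.≤ᵇ⇒≤ tt
  ... | false | false | true  = ℚP.≤ᵇ⇒≤ tt
  ... | false | false | false = ℚP.≤ᵇ⇒≤ tt

combination : ∀ {k} → (Fin k → ℚ) → (Fin k → ℚ) → ℚ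
combination l f = sum (λ i → l i * f i)

module _ {k} (l : Fin k → ℚ) where

  combination-+ : ∀ f g → combination l f + combination l g ≡ combination l (λ i → f i + g i)
  combination-+ f g = sym (trans (sum-cong-≗ (λ i → ℚP.*-distribˡ-+ (l i) (f i) (g i)))
                                 (∑-distrib-+ (λ i → l i * f i) (λ i → l i * g i)))

  combination-sum : ∀ {j} (f : Fin j → Fin k → ℚ) →
    sum (λ e → combination l (f e)) ≡ combination l (λ i → sum (λ e → f e i))
  combination-sum f = trans (∑-comm (λ e i → l i * f e i))
                            (sum-cong-≗ (λ i → sym (*-distribˡ-sum (l i) (λ e → f e i))))

  combination-if : ∀ c f →
    (if c then combination l f else 0ℚ) ≡ combination l (λ i → if c then f i else 0ℚ)
  combination-if true f = refl
  combination-if false f = sym (trans (sum-cong-≗ (λ i → ℚP.*-zeroʳ (l i))) (sum-replicate-zero k))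

  module _ (l≥0 : ∀ i → 0ℚ ≤ l i) where

    private
      *-monoˡ : ∀ {c p q} → 0ℚ ≤ c → p ≤ q → c * p ≤ c * q
      *-monoˡ {c} c≥0 = ℚP.*-monoˡ-≤-nonNeg c {{ℚ.nonNegative c≥0}}

    combination-nonneg : ∀ {f} → (∀ i → 0ℚ ≤ f i) → 0ℚ ≤ combination l f
    combination-nonneg {f} f≥0 = begin
      0ℚ                        ≡⟨ sum-replicate-zero k ⟨
      sum (λ (_ : Fin k) → 0ℚ)  ≡⟨ sum-cong-≗ (λ i → ℚP.*-zeroʳ (l i)) ⟨
      sum (λ i → l i * 0ℚ)      ≤⟨ sum-mono-≤ (λ i → *-monoˡ (l≥0 i) (f≥0 i)) ⟩
      combination l f           ∎
      where open ℚP.≤-Reasoning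

    convex-≤-1 : ∀ {f} → sum l ≡ 1ℚ → (∀ i → f i ≤ 1ℚ) → combination l f ≤ 1ℚ
    convex-≤-1 {f} ∑l≡1 f≤1 = begin
      combination l f       ≤⟨ sum-mono-≤ (λ i → *-monoˡ (l≥0 i) (f≤1 i)) ⟩
      sum (λ i → l i * 1ℚ)  ≡⟨ sum-cong-≗ (λ i → ℚP.*-identityʳ (l i)) ⟩
      sum l                 ≡⟨ ∑l≡1 ⟩
      1ℚ                    ∎
      where open ℚP.≤-Reasoning

module _ {n m k} (ends : Ends n m) (l : Fin k → ℚ)
         {x : Fin n → ℚ} {y : Fin m → ℚ} {xs : Fin k → Fin n → ℚ} {ys : Fin k → Fin m → ℚ}
         (x≡ : ∀ v → x v ≡ combination l (λ i → xs i v))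
         (y≡ : ∀ e → y e ≡ combination l (λ i → ys i e)) where

  vertexLoad-combination : ∀ v →
    vertexLoad ends x y v ≡ combination l (λ i → vertexLoad ends (xs i) (ys i) v)
  vertexLoad-combination v = begin
    x v + sum (λ e → at e (y e))
      ≡⟨ cong₂ _+_ (x≡ v) (sum-cong-≗ (λ e →
           trans (cong (at e) (y≡ e)) (combination-if l (incident? ends v e) (λ i → ys i e)))) ⟩
    combination l (λ i → xs i v) + sum (λ e → combination l (λ i → at e (ys i e)))
      ≡⟨ cong (combination l (λ i → xs i v) +_) (combination-sum l (λ e i → at e (ys i e))) ⟩
    combination l (λ i → xs i v) + combination l (λ i → sum (λ e → at e (ys i e)))
      ≡⟨ combination-+ l _ _ ⟩
    combination l (λ i → vertexLoad ends (xs i) (ys i) v) ∎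
    where
    open ≡-Reasoning

    at : Fin m → ℚ → ℚ
    at e z = if incident? ends v e then z else 0ℚ

  edgeLoad-combination : ∀ e →
    edgeLoad ends x y e ≡ combination l (λ i → edgeLoad ends (xs i) (ys i) e)
  edgeLoad-combination e =
    trans (cong₂ _+_ (trans (cong₂ _+_ (x≡ p) (x≡ q)) (combination-+ l (λ i → xs i p) (λ i → xs i q)))
                     (y≡ e))
          (combination-+ l (λ i → xs i p + xs i q) (λ i → ys i e))
    where
    p = proj₁ (ends e)
    q = proj₂ (ends e)

PT⊆Q : ∀ {n m} (ends : Ends n m) {x y} → InPT ends x y → InQ ends x y
PT⊆Q ends {x} {y} (k , l , a , b , matching , l≥0 , Σl≡1 , x≡ , y≡) =
  vertex , edge ,
  (λ v → subst (0ℚ ≤_) (sym (x≡′ v)) (combination-nonneg l l≥0 (λ i → χ-nonneg (a i v)))) ,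
  (λ e → subst (0ℚ ≤_) (sym (y≡′ e)) (combination-nonneg l l≥0 (λ i → χ-nonneg (b i e))))
  where
  open ℚP.≤-Reasoning

  x≡′ : ∀ v → x v ≡ combination l (λ i → χ (a i v))
  x≡′ v = trans (x≡ v) (Σ≡sum (λ i → l i * χ (a i v)))

  y≡′ : ∀ e → y e ≡ combination l (λ i → χ (b i e))
  y≡′ e = trans (y≡ e) (Σ≡sum (λ i → l i * χ (b i e)))

  ∑l≡1 : sum l ≡ 1ℚ
  ∑l≡1 = trans (sym (Σ≡sum l)) Σl≡1

  vertex : ∀ v → x v + Σ[ (λ e → if incident? ends v e then y e else 0ℚ) ] ≤ 1ℚ
  vertex v = begin
    x v + Σ[ y-at-v ]
      ≡⟨ cong (x v +_) (Σ≡sum y-at-v) ⟩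
    vertexLoad ends x y v
      ≡⟨ vertexLoad-combination ends l x≡′ y≡′ v ⟩
    combination l (λ i → vertexLoad ends (χ ∘ a i) (χ ∘ b i) v)
      ≤⟨ convex-≤-1 l l≥0 ∑l≡1 (λ i → vertexLoad-≤-1 (matching i) v) ⟩
    1ℚ ∎
    where
    y-at-v : Fin _ → ℚ
    y-at-v e = if incident? ends v e then y e else 0ℚ

  edge : ∀ e → edgeLoad ends x y e ≤ 1ℚ
  edge e = begin
    edgeLoad ends x y e
      ≡⟨ edgeLoad-combination ends l x≡′ y≡′ e ⟩
    combination l (λ i → edgeLoad ends (χ ∘ a i) (χ ∘ b i) e)
      ≤⟨ convex-≤-1 l l≥0 ∑l≡1 (λ i → edgeLoad-≤-1 (matching i) e) ⟩
    1ℚ ∎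

-- Walks, paths and components

module _ {n m} (ends : Ends n (suc m)) where

  Adj-tail : ∀ {u v} → Adj (tail ends) u v → Adj ends u v
  Adj-tail (e , j) = suc e , j

  Walk-tail : ∀ {u v} → Walk (tail ends) u v → Walk ends u v
  Walk-tail here = here
  Walk-tail (step uv w) = step (Adj-tail uv) (Walk-tail w)

  IsSimple-tail : IsSimple ends → IsSimple (tail ends)
  IsSimple-tail (loopless , unique) = loopless ∘ suc , λ e f j → suc-injective (unique (suc e) (suc f) j)

  Acyclic-tail : Acyclic ends → Acyclic (tail ends)
  Acyclic-tail acyclic k c (injective , adjacent , closing) =
    acyclic k c (injective , Adj-tail ∘ adjacent , Adj-tail closing)

module _ {n m} {ends : Ends n m} where

  infixr 5 _++ᵂ_
  _++ᵂ_ : ∀ {u v w} → Walk ends u v → Walk ends v w → Walk ends u w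
  here ++ᵂ w = w
  step a r ++ᵂ w = step a (r ++ᵂ w)

  infix 4 _∈ᵂ_
  _∈ᵂ_ : ∀ {u v} → Fin n → Walk ends u v → Set
  x ∈ᵂ here {u} = x ≡ u
  x ∈ᵂ step {u} _ w = x ≡ u ⊎ x ∈ᵂ w

  _∈ᵂ?_ : ∀ {u v} x (w : Walk ends u v) → Dec (x ∈ᵂ w)
  x ∈ᵂ? here {u} = x Fin.≟ u
  x ∈ᵂ? step {u} _ w = (x Fin.≟ u) ⊎-dec (x ∈ᵂ? w)

  IsPath : ∀ {u v} → Walk ends u v → Set
  IsPath here = ⊤
  IsPath (step {u} _ w) = ¬ u ∈ᵂ w × IsPath w

  suffixFrom : ∀ {x u v} (w : Walk ends u v) → x ∈ᵂ w → IsPath w → Σ (Walk ends x v) IsPath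
  suffixFrom here refl _ = here , tt
  suffixFrom (step a w) (inj₁ refl) path = step a w , path
  suffixFrom (step a w) (inj₂ x∈w) (_ , path) = suffixFrom w x∈w path

  toPath : ∀ {u v} → Walk ends u v → Σ (Walk ends u v) IsPath
  toPath here = here , tt
  toPath {u} (step a w) with toPath w
  ... | p , path with u ∈ᵂ? p
  ...   | yes u∈p = suffixFrom p u∈p path
  ...   | no u∉p = step a p , u∉p , path

  length : ∀ {u v} → Walk ends u v → ℕ
  length here = 0
  length (step _ w) = suc (length w)

  vertexAt : ∀ {u v} (w : Walk ends u v) → Fin (suc (length w)) → Fin n
  vertexAt {u} here zero = u
  vertexAt {u} (step _ w) zero = u
  vertexAt (step _ w) (suc i) = vertexAt w i

  vertexAt-zero : ∀ {u v} (w : Walk ends u v) → vertexAt w zero ≡ u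
  vertexAt-zero here = refl
  vertexAt-zero (step _ _) = refl

  vertexAt-last : ∀ {u v} (w : Walk ends u v) → vertexAt w (Fin.fromℕ (length w)) ≡ v
  vertexAt-last here = refl
  vertexAt-last (step _ w) = vertexAt-last w

  vertexAt-∈ᵂ : ∀ {u v} (w : Walk ends u v) i → vertexAt w i ∈ᵂ w
  vertexAt-∈ᵂ here zero = refl
  vertexAt-∈ᵂ (step _ w) zero = inj₁ refl
  vertexAt-∈ᵂ (step _ w) (suc i) = inj₂ (vertexAt-∈ᵂ w i)

  vertexAt-adjacent : ∀ {u v} (w : Walk ends u v) i →
    Adj ends (vertexAt w (Fin.inject₁ i)) (vertexAt w (suc i))
  vertexAt-adjacent (step uv w) zero = subst (Adj ends _) (sym (vertexAt-zero w)) uv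
  vertexAt-adjacent (step _ w) (suc i) = vertexAt-adjacent w i

  vertexAt-injective : ∀ {u v} (w : Walk ends u v) → IsPath w → Injective (vertexAt w)
  vertexAt-injective here _ zero zero _ = refl
  vertexAt-injective (step _ w) _ zero zero _ = refl
  vertexAt-injective (step _ w) (u∉w , _) zero (suc j) u≡wj =
    ⊥-elim (u∉w (subst (_∈ᵂ w) (sym u≡wj) (vertexAt-∈ᵂ w j)))
  vertexAt-injective (step _ w) (u∉w , _) (suc i) zero wi≡u =
    ⊥-elim (u∉w (subst (_∈ᵂ w) wi≡u (vertexAt-∈ᵂ w i)))
  vertexAt-injective (step _ w) (_ , path) (suc i) (suc j) wi≡wj =
    cong suc (vertexAt-injective w path i j wi≡wj)

-- A path between the ends of edge zero avoiding it is closed by it into a cycle, unless the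
-- path has length 0 or 1, which would make edge zero a loop or a parallel edge.
tail-separates : ∀ {n m} (ends : Ends n (suc m)) → IsSimple ends → Acyclic ends →
  ¬ Walk (tail ends) (proj₁ (ends zero)) (proj₂ (ends zero))
tail-separates ends (loopless , unique) acyclic w = closesCycle (proj₁ (toPath w)) (proj₂ (toPath w)) refl
  where
  closesCycle : ∀ {u v} (w : Walk (tail ends) u v) → IsPath w → ends zero ≡ (u , v) → ⊥
  closesCycle here _ eq = loopless zero (trans (cong proj₁ eq) (sym (cong proj₂ eq)))
  closesCycle (step (g , j) here) _ eq
    with () ← unique zero (suc g) (subst (λ uv → Joins ends (suc g) (proj₁ uv) (proj₂ uv)) (sym eq) j)
  closesCycle w@(step _ (step _ _)) path eq =
    acyclic _ (vertexAt w) (vertexAt-injective w path , Adj-tail ends ∘ vertexAt-adjacent w , closing)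
    where
    closing : Adj ends (vertexAt w (Fin.fromℕ (length w))) (vertexAt w zero)
    closing = subst (λ x → Adj ends x _) (sym (vertexAt-last w)) (zero , inj₂ eq)

record Components {n m} (ends : Ends n m) : Set where
  field
    component : Fin n → Fin n
    component-edge : ∀ e → component (proj₁ (ends e)) ≡ component (proj₂ (ends e))
    component-walk : ∀ {u v} → component u ≡ component v → Walk ends u v

components : ∀ {n m} (ends : Ends n m) → Components ends
components {m = zero} ends = record
  { component = λ v → v ; component-edge = λ () ; component-walk = λ { refl → here } }
components {n} {suc m} ends = record
  { component = c ; component-edge = c-edge ; component-walk = c-walk }
  where
  open Components (components (tail ends)) renaming
    (component to c′; component-edge to c′-edge; component-walk to c′-walk)
  a = proj₁ (ends zero)
  b = proj₂ (ends zero)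

  c : Fin n → Fin n
  c v = if ⌊ c′ v Fin.≟ c′ b ⌋ then c′ a else c′ v

  c-b : c b ≡ c′ a
  c-b with c′ b Fin.≟ c′ b
  ... | yes _ = refl
  ... | no ≢ = ⊥-elim (≢ refl)

  c-a : c a ≡ c′ a
  c-a with c′ a Fin.≟ c′ b
  ... | yes _ = refl
  ... | no _ = refl

  c-edge : ∀ e → c (proj₁ (ends e)) ≡ c (proj₂ (ends e))
  c-edge zero = trans c-a (sym c-b)
  c-edge (suc e) with c′ (proj₁ (ends (suc e))) Fin.≟ c′ b | c′ (proj₂ (ends (suc e))) Fin.≟ c′ b
  ... | yes _ | yes _ = refl
  ... | yes x~b | no y≁b = ⊥-elim (y≁b (trans (sym (c′-edge e)) x~b))
  ... | no x≁b | yes y~b = ⊥-elim (x≁b (trans (c′-edge e) y~b))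
  ... | no _ | no _ = c′-edge e

  c-walk : ∀ {u v} → c u ≡ c v → Walk ends u v
  c-walk {u} {v} cu≡cv with c′ u Fin.≟ c′ b | c′ v Fin.≟ c′ b
  ... | yes u~b | yes v~b = Walk-tail ends (c′-walk (trans u~b (sym v~b)))
  ... | yes u~b | no _ =
    Walk-tail ends (c′-walk u~b) ++ᵂ step (zero , inj₂ refl) (Walk-tail ends (c′-walk cu≡cv))
  ... | no _ | yes v~b =
    Walk-tail ends (c′-walk cu≡cv) ++ᵂ step (zero , inj₁ refl) (Walk-tail ends (c′-walk (sym v~b)))
  ... | no _ | no _ = Walk-tail ends (c′-walk cu≡cv)

-- Colour sets

∣p∪q∣≤∣p∣+∣q∣ : ∀ {d} (p q : Subset d) → ∣ p ∪ q ∣ ℕ.≤ ∣ p ∣ ℕ.+ ∣ q ∣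
∣p∪q∣≤∣p∣+∣q∣ [] [] = ℕ.z≤n
∣p∪q∣≤∣p∣+∣q∣ (outside ∷ p) (outside ∷ q) = ∣p∪q∣≤∣p∣+∣q∣ p q
∣p∪q∣≤∣p∣+∣q∣ (outside ∷ p) (inside ∷ q) =
  ℕP.≤-trans (ℕ.s≤s (∣p∪q∣≤∣p∣+∣q∣ p q)) (ℕP.≤-reflexive (sym (ℕP.+-suc ∣ p ∣ ∣ q ∣)))
∣p∪q∣≤∣p∣+∣q∣ (inside ∷ p) (s ∷ q) =
  ℕ.s≤s (ℕP.≤-trans (∣p∪q∣≤∣p∣+∣q∣ p q) (ℕP.+-monoʳ-≤ ∣ p ∣ (∣p∣≤∣x∷p∣ s q)))

subset-of-size : ∀ {d} k (p : Subset d) → k ℕ.≤ ∣ p ∣ → Σ[ q ∈ Subset d ] q ⊆ p × ∣ q ∣ ≡ k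
subset-of-size zero [] _ = [] , (λ ()) , refl
subset-of-size k (outside ∷ p) k≤∣p∣ with q , q⊆p , ∣q∣≡k ← subset-of-size k p k≤∣p∣ =
  outside ∷ q , out⊆ q⊆p , ∣q∣≡k
subset-of-size {suc d} zero (inside ∷ p) _ = ∅ , ⊥⊆ , ∣⊥∣≡0 (suc d)
subset-of-size (suc k) (inside ∷ p) (ℕ.s≤s k≤∣p∣)
  with q , q⊆p , ∣q∣≡k ← subset-of-size k p k≤∣p∣ = inside ∷ q , s⊆s q⊆p , cong suc ∣q∣≡k

Disjoint : ∀ {d} → Subset d → Subset d → Set
Disjoint S T = S ⊆ ∁ T

module _ {d : ℕ} where

  Disjoint-∉ : {S T : Subset d} {i : Fin d} → Disjoint S T → i Sub.∈ S → i Sub.∉ T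
  Disjoint-∉ S#T i∈S = x∈∁p⇒x∉p (S#T i∈S)

  Disjoint-sym : {S T : Subset d} → Disjoint S T → Disjoint T S
  Disjoint-sym S#T i∈T = x∉p⇒x∈∁p (λ i∈S → Disjoint-∉ S#T i∈S i∈T)

  Disjoint-⊆ : {S T T′ : Subset d} → T′ ⊆ T → Disjoint S T → Disjoint S T′
  Disjoint-⊆ T′⊆T S#T = ⊆-trans S#T (p⊆q⇒∁p⊇∁q T′⊆T)

  disjoint-of-size : ∀ k (W : Subset d) → ∣ W ∣ ℕ.+ k ℕ.≤ d →
    Σ[ S ∈ Subset d ] ∣ S ∣ ≡ k × Disjoint S W
  disjoint-of-size k W room =
    let S , S⊆∁W , ∣S∣≡k = subset-of-size k (∁ W) k≤∣∁W∣ in S , ∣S∣≡k , S⊆∁W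
    where
    k≤∣∁W∣ : k ℕ.≤ ∣ ∁ W ∣
    k≤∣∁W∣ = subst₂ ℕ._≤_ (ℕP.m+n∸m≡n ∣ W ∣ k) (sym (∣∁p∣≡n∸∣p∣ W)) (ℕP.∸-monoˡ-≤ ∣ W ∣ room)

⋃ᶠ : ∀ {k d} → (Fin k → Subset d) → Subset d
⋃ᶠ = foldr _∪_ ∅

⊆-⋃ᶠ : ∀ {k d} (F : Fin k → Subset d) i → F i ⊆ ⋃ᶠ F
⊆-⋃ᶠ F zero = p⊆p∪q _
⊆-⋃ᶠ F (suc i) = ⊆-trans (⊆-⋃ᶠ (F ∘ suc) i) (q⊆p∪q (F zero) _)

∣⋃ᶠ∣≤sum : ∀ {k d} (F : Fin k → Subset d) → ∣ ⋃ᶠ F ∣ ℕ.≤ sumℕ (∣_∣ ∘ F)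
∣⋃ᶠ∣≤sum {zero} {d} F = ℕP.≤-reflexive (∣⊥∣≡0 d)
∣⋃ᶠ∣≤sum {suc k} F = ℕP.≤-trans (∣p∪q∣≤∣p∣+∣q∣ (F zero) (⋃ᶠ (F ∘ suc)))
                                (ℕP.+-monoʳ-≤ ∣ F zero ∣ (∣⋃ᶠ∣≤sum (F ∘ suc)))

-- Total colourings of forests

degree : ∀ {n m} → Ends n m → (Fin m → ℕ) → Fin n → ℕ
degree ends Y v = sumℕ (λ e → if incident? ends v e then Y e else 0)

record Feasible (D : ℕ) {n m} (ends : Ends n m) (X : Fin n → ℕ) (Y : Fin m → ℕ) : Set where
  field
    vertex-room : ∀ v → X v ℕ.+ degree ends Y v ℕ.≤ D
    edge-room : ∀ e → X (proj₁ (ends e)) ℕ.+ X (proj₂ (ends e)) ℕ.+ Y e ℕ.≤ D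

record TotalColouring (D : ℕ) {n m} (ends : Ends n m) (X : Fin n → ℕ) (Y : Fin m → ℕ) : Set where
  field
    vertexColours : Fin n → Subset D
    edgeColours : Fin m → Subset D
    ∣vertexColours∣ : ∀ v → ∣ vertexColours v ∣ ≡ X v
    ∣edgeColours∣ : ∀ e → ∣ edgeColours e ∣ ≡ Y e
    vertex-vertex : ∀ e → Disjoint (vertexColours (proj₁ (ends e))) (vertexColours (proj₂ (ends e)))
    edge-edge : ∀ {v e f} → e ≢ f → Incident ends v e → Incident ends v f →
                Disjoint (edgeColours e) (edgeColours f)
    vertex-edge : ∀ {v e} → Incident ends v e → Disjoint (vertexColours v) (edgeColours e)

  coloursAround : Fin n → Subset D
  coloursAround v = ⋃ᶠ (λ e → if incident? ends v e then edgeColours e else ∅)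

  ⊆-coloursAround : ∀ {v e} → Incident ends v e → edgeColours e ⊆ coloursAround v
  ⊆-coloursAround {v} {e} v∈e = ⊆-trans (selected (incident?-complete ends v∈e)) (⊆-⋃ᶠ _ e)
    where
    selected : ∀ {b} → T b → edgeColours e ⊆ (if b then edgeColours e else ∅)
    selected {true} _ i∈e = i∈e

  ∣coloursAround∣ : ∀ v → ∣ coloursAround v ∣ ℕ.≤ degree ends Y v
  ∣coloursAround∣ v = ℕP.≤-trans (∣⋃ᶠ∣≤sum (λ e → if incident? ends v e then edgeColours e else ∅))
                                   (ℕP.≤-reflexive (sumℕ-cong-≗ size))
    where
    size : ∀ e →
      ∣ if incident? ends v e then edgeColours e else ∅ ∣ ≡ (if incident? ends v e then Y e else 0)
    size e with incident? ends v e
    ... | true = ∣edgeColours∣ e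
    ... | false = ∣⊥∣≡0 D

open TotalColouring

record Avoids {D n m} {ends : Ends n m} {X Y} (col : TotalColouring D ends X Y)
              (r : Fin n) (W₁ W₂ : Subset D) : Set where
  field
    vertex-avoids : Disjoint (vertexColours col r) W₁
    edges-avoid : ∀ {e} → Incident ends r e → Disjoint (edgeColours col e) W₂

module _ {n m} (ends : Ends n (suc m)) (Y : Fin (suc m) → ℕ) where

  degree-tail-≤ : ∀ v → degree (tail ends) (tail Y) v ℕ.≤ degree ends Y v
  degree-tail-≤ v = ℕP.m≤n+m _ (if incident? ends v zero then Y zero else 0)

  degree-incident : ∀ {v} → Incident ends v zero →
    degree ends Y v ≡ Y zero ℕ.+ degree (tail ends) (tail Y) v
  degree-incident {v} v∈e₀ with incident? ends v zero | incident?-complete ends v∈e₀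
  ... | true | _ = refl

Feasible-tail : ∀ {D n m} {ends : Ends n (suc m)} {X Y} →
  Feasible D ends X Y → Feasible D (tail ends) X (tail Y)
Feasible-tail {ends = ends} {X} {Y} feasible = record
  { vertex-room = λ v → ℕP.≤-trans (ℕP.+-monoʳ-≤ (X v) (degree-tail-≤ ends Y v)) (vertex-room v)
  ; edge-room = edge-room ∘ suc
  }
  where open Feasible feasible

module Glue {D n m} {ends : Ends n (suc m)} {X : Fin n → ℕ} {Y : Fin (suc m) → ℕ}
  (C : Components (tail ends)) {p q : Fin n} (pq : Joins ends zero p q)
  (p≁q : Components.component C p ≢ Components.component C q)
  (old new : TotalColouring D (tail ends) X (tail Y))
  (S : Subset D) (∣S∣ : ∣ S ∣ ≡ Y zero)
  (p-avoids : Disjoint (vertexColours old p) S)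
  (around-p-avoids : ∀ {f} → Incident (tail ends) p f → Disjoint (edgeColours old f) S)
  (new-avoids : Avoids new q (vertexColours old p ∪ S) S)
  where

  open Components C
  open Avoids new-avoids

  -- The glued colouring follows `new` on the component of q and `old` elsewhere.  Both ends of
  -- an edge of the tail lie in one component, so each constraint not involving e₀ holds in
  -- whichever colouring is picked.
  private
    pick : ∀ {A : Set} → Fin n → A → A → A
    pick v x y = if ⌊ component v Fin.≟ component q ⌋ then x else y

    pick-elim : ∀ {A : Set} (P : A → Set) v {x y} → P x → P y → P (pick v x y)
    pick-elim P v Px Py with component v Fin.≟ component q
    ... | yes _ = Px
    ... | no _ = Py

    pick-elim₂ : ∀ {A B : Set} (R : A → B → Set) {u v x x′ y y′} → component u ≡ component v →
      R x x′ → R y y′ → R (pick u x y) (pick v x′ y′)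
    pick-elim₂ R {u} {v} u~v Rx Ry with component u Fin.≟ component q | component v Fin.≟ component q
    ... | yes _ | yes _ = Rx
    ... | no _ | no _ = Ry
    ... | yes u~q | no v≁q = ⊥-elim (v≁q (trans (sym u~v) u~q))
    ... | no u≁q | yes v~q = ⊥-elim (u≁q (trans u~v v~q))

    pick-on : ∀ {A : Set} {x y : A} v → component v ≡ component q → pick v x y ≡ x
    pick-on v v~q with component v Fin.≟ component q
    ... | yes _ = refl
    ... | no v≁q = ⊥-elim (v≁q v~q)

    pick-off : ∀ {A : Set} {x y : A} v → component v ≢ component q → pick v x y ≡ y
    pick-off v v≁q with component v Fin.≟ component q
    ... | yes v~q = ⊥-elim (v≁q v~q)
    ... | no _ = refl

    incident-component : ∀ {v f} → Incident (tail ends) v f → component v ≡ component (proj₁ (ends (suc f)))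
    incident-component (inj₁ x) = cong component (sym x)
    incident-component {f = f} (inj₂ x) = trans (cong component (sym x)) (sym (component-edge f))

    vc : Fin n → Subset D
    vc v = pick v (vertexColours new v) (vertexColours old v)

    ec : Fin (suc m) → Subset D
    ec zero = S
    ec (suc f) = pick (proj₁ (ends (suc f))) (edgeColours new f) (edgeColours old f)

  vertexColours-off : ∀ {v} → component v ≢ component q → vc v ≡ vertexColours old v
  vertexColours-off = pick-off _

  edgeColours-off : ∀ {v f} → Incident (tail ends) v f → component v ≢ component q →
    ec (suc f) ≡ edgeColours old f
  edgeColours-off v∈f v≁q = pick-off _ (v≁q ∘ trans (incident-component v∈f))

  private
    edgeColours-on : ∀ {f} → Incident (tail ends) q f → ec (suc f) ≡ edgeColours new f
    edgeColours-on q∈f = pick-on _ (sym (incident-component q∈f))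

    vertex-vertex′ : ∀ e → Disjoint (vc (proj₁ (ends e))) (vc (proj₂ (ends e)))
    vertex-vertex′ zero = Joins-endpoints⁺ ends (λ u v → Disjoint (vc u) (vc v)) Disjoint-sym pq
      (subst₂ Disjoint (sym (vertexColours-off p≁q)) (sym (pick-on q refl))
              (Disjoint-sym (Disjoint-⊆ (p⊆p∪q S) vertex-avoids)))
    vertex-vertex′ (suc f) = pick-elim₂ Disjoint (component-edge f) (vertex-vertex new f) (vertex-vertex old f)

    S-avoids-around : ∀ {v f} → Incident ends v zero → Incident (tail ends) v f → Disjoint S (ec (suc f))
    S-avoids-around v∈e₀ v∈f with Joins-incident ends pq v∈e₀
    ... | inj₁ refl = subst (Disjoint S) (sym (edgeColours-off v∈f p≁q)) (Disjoint-sym (around-p-avoids v∈f))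
    ... | inj₂ refl = subst (Disjoint S) (sym (edgeColours-on v∈f)) (Disjoint-sym (edges-avoid v∈f))

    edge-edge′ : ∀ {v e f} → e ≢ f → Incident ends v e → Incident ends v f → Disjoint (ec e) (ec f)
    edge-edge′ {e = zero} {zero} e≢f _ _ = ⊥-elim (e≢f refl)
    edge-edge′ {e = zero} {suc f} _ v∈e v∈f = S-avoids-around v∈e v∈f
    edge-edge′ {e = suc e} {zero} _ v∈e v∈f = Disjoint-sym (S-avoids-around v∈f v∈e)
    edge-edge′ {e = suc e} {suc f} e≢f v∈e v∈f =
      pick-elim₂ Disjoint (trans (sym (incident-component v∈e)) (incident-component v∈f))
        (edge-edge new (e≢f ∘ cong suc) v∈e v∈f) (edge-edge old (e≢f ∘ cong suc) v∈e v∈f)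

    vertex-edge′ : ∀ {v e} → Incident ends v e → Disjoint (vc v) (ec e)
    vertex-edge′ {e = zero} v∈e₀ with Joins-incident ends pq v∈e₀
    ... | inj₁ refl = subst (λ T → Disjoint T S) (sym (vertexColours-off p≁q)) p-avoids
    ... | inj₂ refl =
      subst (λ T → Disjoint T S) (sym (pick-on q refl)) (Disjoint-⊆ (q⊆p∪q _ S) vertex-avoids)
    vertex-edge′ {e = suc f} v∈f =
      pick-elim₂ Disjoint (incident-component v∈f) (vertex-edge new v∈f) (vertex-edge old v∈f)

    ∣ec∣ : ∀ e → ∣ ec e ∣ ≡ Y e
    ∣ec∣ zero = ∣S∣
    ∣ec∣ (suc f) = pick-elim (λ T → ∣ T ∣ ≡ Y (suc f)) _ (∣edgeColours∣ new f) (∣edgeColours∣ old f)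

  glued : TotalColouring D ends X Y
  glued = record
    { vertexColours = vc
    ; edgeColours = ec
    ; ∣vertexColours∣ = λ v →
        pick-elim (λ T → ∣ T ∣ ≡ X v) v (∣vertexColours∣ new v) (∣vertexColours∣ old v)
    ; ∣edgeColours∣ = ∣ec∣
    ; vertex-vertex = vertex-vertex′
    ; edge-edge = edge-edge′
    ; vertex-edge = vertex-edge′
    }

RootedColourable : (D : ℕ) {n m : ℕ} → Ends n m → (Fin n → ℕ) → (Fin m → ℕ) → Set
RootedColourable D {n} ends X Y = ∀ (r : Fin n) W₁ W₂ →
  ∣ W₁ ∣ ℕ.+ X r ℕ.≤ D → ∣ W₂ ∣ ℕ.+ X r ℕ.+ degree ends Y r ℕ.≤ D →
  Σ[ col ∈ TotalColouring D ends X Y ] Avoids col r W₁ W₂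

colour-edgeless : ∀ {D n} (ends : Ends n 0) {X Y} → (∀ v → X v ℕ.≤ D) → RootedColourable D ends X Y
colour-edgeless {D} ends {X} X≤D r W₁ _ room₁ _ =
  colouring , record { vertex-avoids = proj₂ (proj₂ (choice r)) refl ; edges-avoid = λ { {e = ()} } }
  where
  choice : ∀ v → Σ[ T ∈ Subset D ] ∣ T ∣ ≡ X v × (v ≡ r → Disjoint T W₁)
  choice v with v Fin.≟ r
  ... | yes refl = let T , ∣T∣ , T#W₁ = disjoint-of-size (X v) W₁ room₁ in T , ∣T∣ , λ _ → T#W₁
  ... | no v≢r = let T , ∣T∣ , _ = disjoint-of-size (X v) ∅ room in T , ∣T∣ , ⊥-elim ∘ v≢r
    where
    room : ∣ ∅ {D} ∣ ℕ.+ X v ℕ.≤ D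
    room = subst (λ k → k ℕ.+ X v ℕ.≤ D) (sym (∣⊥∣≡0 D)) (X≤D v)

  colouring : TotalColouring D ends X _
  colouring = record
    { vertexColours = proj₁ ∘ choice
    ; edgeColours = λ ()
    ; ∣vertexColours∣ = proj₁ ∘ proj₂ ∘ choice
    ; ∣edgeColours∣ = λ ()
    ; vertex-vertex = λ ()
    ; edge-edge = λ { {e = ()} }
    ; vertex-edge = λ { {e = ()} }
    }

private
  a+b+[c+d]≡a+[b+d]+c : ∀ a b c d → a ℕ.+ b ℕ.+ (c ℕ.+ d) ≡ a ℕ.+ (b ℕ.+ d) ℕ.+ c
  a+b+[c+d]≡a+[b+d]+c = solve-∀

module Extend {D n m} {ends : Ends n (suc m)} {X : Fin n → ℕ} {Y : Fin (suc m) → ℕ}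
  (feasible : Feasible D ends X Y) (colour′ : RootedColourable D (tail ends) X (tail Y))
  (C : Components (tail ends)) {p q r : Fin n} (pq : Joins ends zero p q)
  (p≁q : Components.component C p ≢ Components.component C q)
  (r≁q : Components.component C r ≢ Components.component C q)
  {W₁ W₂ : Subset D} (room₁ : ∣ W₁ ∣ ℕ.+ X r ℕ.≤ D)
  (room₂ : ∣ W₂ ∣ ℕ.+ X r ℕ.+ degree ends Y r ℕ.≤ D)
  where

  open Feasible feasible
  open Components C
  open ℕP.≤-Reasoning

  private
    degree′ : Fin n → ℕ
    degree′ = degree (tail ends) (tail Y)

    old-avoiding : Σ[ col ∈ TotalColouring D (tail ends) X (tail Y) ] Avoids col r W₁ W₂
    old-avoiding = colour′ r W₁ W₂ room₁
      (ℕP.≤-trans (ℕP.+-monoʳ-≤ (∣ W₂ ∣ ℕ.+ X r) (degree-tail-≤ ends Y r)) room₂)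

    old : TotalColouring D (tail ends) X (tail Y)
    old = proj₁ old-avoiding
    module OldAvoids = Avoids (proj₂ old-avoiding)

    -- When r = p the edge e₀ lies at r, so its colours must avoid W₂ as well.
    forbiddenAt-p : Σ[ W ∈ Subset D ] ∣ W ∣ ℕ.+ X p ℕ.+ degree ends Y p ℕ.≤ D × (r ≡ p → W₂ ⊆ W)
    forbiddenAt-p with r Fin.≟ p
    ... | yes refl = W₂ , room₂ , λ _ i∈W₂ → i∈W₂
    ... | no r≢p = ∅ , subst (λ k → k ℕ.+ X p ℕ.+ degree ends Y p ℕ.≤ D) (sym (∣⊥∣≡0 D)) (vertex-room p)
                     , ⊥-elim ∘ r≢p

    W : Subset D
    W = proj₁ forbiddenAt-p

    taken : Subset D
    taken = W ∪ (vertexColours old p ∪ coloursAround old p)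

    room-taken : ∣ taken ∣ ℕ.+ Y zero ℕ.≤ D
    room-taken = begin
      ∣ taken ∣ ℕ.+ Y zero
        ≤⟨ ℕP.+-monoˡ-≤ (Y zero) (ℕP.≤-trans (∣p∪q∣≤∣p∣+∣q∣ W _) (ℕP.+-monoʳ-≤ ∣ W ∣
             (ℕP.≤-trans (∣p∪q∣≤∣p∣+∣q∣ (vertexColours old p) _)
                         (ℕP.+-mono-≤ (ℕP.≤-reflexive (∣vertexColours∣ old p)) (∣coloursAround∣ old p))))) ⟩
      ∣ W ∣ ℕ.+ (X p ℕ.+ degree′ p) ℕ.+ Y zero
        ≡⟨ a+b+[c+d]≡a+[b+d]+c ∣ W ∣ (X p) (Y zero) (degree′ p) ⟨
      ∣ W ∣ ℕ.+ X p ℕ.+ (Y zero ℕ.+ degree′ p)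
        ≡⟨ cong (∣ W ∣ ℕ.+ X p ℕ.+_) (degree-incident ends Y (Joins-incidentˡ ends pq)) ⟨
      ∣ W ∣ ℕ.+ X p ℕ.+ degree ends Y p
        ≤⟨ proj₁ (proj₂ forbiddenAt-p) ⟩
      D ∎

    edge₀-choice : Σ[ S ∈ Subset D ] ∣ S ∣ ≡ Y zero × Disjoint S taken
    edge₀-choice = disjoint-of-size (Y zero) taken room-taken

    S : Subset D
    S = proj₁ edge₀-choice

    ∣S∣ : ∣ S ∣ ≡ Y zero
    ∣S∣ = proj₁ (proj₂ edge₀-choice)

    S#taken : Disjoint S taken
    S#taken = proj₂ (proj₂ edge₀-choice)

    room-q₁ : ∣ vertexColours old p ∪ S ∣ ℕ.+ X q ℕ.≤ D
    room-q₁ = begin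
      ∣ vertexColours old p ∪ S ∣ ℕ.+ X q
        ≤⟨ ℕP.+-monoˡ-≤ (X q) (ℕP.≤-trans (∣p∪q∣≤∣p∣+∣q∣ (vertexColours old p) S)
             (ℕP.≤-reflexive (cong₂ ℕ._+_ (∣vertexColours∣ old p) ∣S∣))) ⟩
      X p ℕ.+ Y zero ℕ.+ X q
        ≡⟨ xy∙z≈xz∙y (X p) (Y zero) (X q) ⟩
      X p ℕ.+ X q ℕ.+ Y zero
        ≤⟨ Joins-endpoints⁻ ends (λ u v → X u ℕ.+ X v ℕ.+ Y zero ℕ.≤ D)
             (λ {u} {v} → subst (ℕ._≤ D) (cong (ℕ._+ Y zero) (ℕP.+-comm (X u) (X v)))) pq (edge-room zero) ⟩
      D ∎

    room-q₂ : ∣ S ∣ ℕ.+ X q ℕ.+ degree′ q ℕ.≤ D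
    room-q₂ = begin
      ∣ S ∣ ℕ.+ X q ℕ.+ degree′ q         ≡⟨ cong (λ k → k ℕ.+ X q ℕ.+ degree′ q) ∣S∣ ⟩
      Y zero ℕ.+ X q ℕ.+ degree′ q       ≡⟨ xy∙z≈y∙xz (Y zero) (X q) (degree′ q) ⟩
      X q ℕ.+ (Y zero ℕ.+ degree′ q)     ≡⟨ cong (X q ℕ.+_) (degree-incident ends Y (Joins-incidentʳ ends pq)) ⟨
      X q ℕ.+ degree ends Y q            ≤⟨ vertex-room q ⟩
      D                                  ∎

    new-avoiding : Σ[ col ∈ TotalColouring D (tail ends) X (tail Y) ] Avoids col q (vertexColours old p ∪ S) S
    new-avoiding = colour′ q (vertexColours old p ∪ S) S room-q₁ room-q₂

    S#W : Disjoint S W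
    S#W = Disjoint-⊆ (p⊆p∪q _) S#taken

    S#p : Disjoint S (vertexColours old p)
    S#p = Disjoint-⊆ (⊆-trans (p⊆p∪q _) (q⊆p∪q W _)) S#taken

    S#around-p : Disjoint S (coloursAround old p)
    S#around-p = Disjoint-⊆ (⊆-trans (q⊆p∪q (vertexColours old p) _) (q⊆p∪q W _)) S#taken

    module G = Glue {ends = ends} {Y = Y} C pq p≁q old (proj₁ new-avoiding) S ∣S∣
      (Disjoint-sym S#p) (λ p∈f → Disjoint-sym (Disjoint-⊆ (⊆-coloursAround old p∈f) S#around-p))
      (proj₂ new-avoiding)

    edges-avoid′ : ∀ {e} → Incident ends r e → Disjoint (edgeColours G.glued e) W₂
    edges-avoid′ {zero} r∈e₀ with Joins-incident ends pq r∈e₀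
    ... | inj₁ r≡p = Disjoint-⊆ (proj₂ (proj₂ forbiddenAt-p) r≡p) S#W
    ... | inj₂ r≡q = ⊥-elim (r≁q (cong component r≡q))
    edges-avoid′ {suc f} r∈f =
      subst (λ T → Disjoint T W₂) (sym (G.edgeColours-off r∈f r≁q)) (OldAvoids.edges-avoid r∈f)

  extended : Σ[ col ∈ TotalColouring D ends X Y ] Avoids col r W₁ W₂
  extended = G.glued , record
    { vertex-avoids = subst (λ T → Disjoint T W₁) (sym (G.vertexColours-off r≁q)) OldAvoids.vertex-avoids
    ; edges-avoid = edges-avoid′
    }

colour-extend : ∀ {D n m} (ends : Ends n (suc m)) → IsSimple ends → Acyclic ends → ∀ {X Y} →
  Feasible D ends X Y → RootedColourable D (tail ends) X (tail Y) → RootedColourable D ends X Y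
colour-extend {D} ends simple acyclic {X} {Y} feasible colour′ r W₁ W₂ room₁ room₂ =
  oriented (component r Fin.≟ component b)
  where
  C = components (tail ends)
  open Components C
  a = proj₁ (ends zero)
  b = proj₂ (ends zero)

  a≁b : component a ≢ component b
  a≁b = tail-separates ends simple acyclic ∘ component-walk

  -- q is the end of e₀ outside the component of r, so recolouring around q leaves r untouched.
  oriented : Dec (component r ≡ component b) → Σ[ col ∈ TotalColouring D ends X Y ] Avoids col r W₁ W₂
  oriented (yes r~b) = Extend.extended feasible colour′ C {p = b} {q = a} (inj₂ refl)
    (a≁b ∘ sym) (λ r~a → a≁b (trans (sym r~a) r~b)) room₁ room₂
  oriented (no r≁b) = Extend.extended feasible colour′ C {p = a} {q = b} (inj₁ refl) a≁b r≁b room₁ room₂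

colour-forest : ∀ {D n m} (ends : Ends n m) → IsSimple ends → Acyclic ends → ∀ {X Y} →
  Feasible D ends X Y → RootedColourable D ends X Y
colour-forest {m = zero} ends _ _ {X} feasible =
  colour-edgeless ends (λ v → ℕP.≤-trans (ℕP.m≤m+n (X v) _) (Feasible.vertex-room feasible v))
colour-forest {m = suc m} ends simple acyclic feasible =
  colour-extend ends simple acyclic feasible
    (colour-forest (tail ends) (IsSimple-tail ends simple) (Acyclic-tail ends acyclic) (Feasible-tail feasible))

forest-colouring : ∀ {D n m} (ends : Ends n m) → IsSimple ends → Acyclic ends → ∀ {X Y} →
  Feasible D ends X Y → TotalColouring D ends X Y
forest-colouring {n = zero} ends _ _ _ = record
  { vertexColours = λ ()
  ; edgeColours = noEdge
  ; ∣vertexColours∣ = λ ()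
  ; ∣edgeColours∣ = λ e → noEdge e
  ; vertex-vertex = λ e → noEdge e
  ; edge-edge = λ {e = e} _ _ _ → noEdge e
  ; vertex-edge = λ {e = e} _ → noEdge e
  }
  where
  noEdge : ∀ {A : Set} → Fin _ → A
  noEdge e with () ← proj₁ (ends e)
forest-colouring {D} {n = suc n} ends simple acyclic {X} {Y} feasible =
  proj₁ (colour-forest ends simple acyclic feasible zero ∅ ∅ room₁ room₂)
  where
  open Feasible feasible
  room₂ : ∣ ∅ {D} ∣ ℕ.+ X zero ℕ.+ degree ends Y zero ℕ.≤ D
  room₂ = subst (λ k → k ℕ.+ X zero ℕ.+ degree ends Y zero ℕ.≤ D) (sym (∣⊥∣≡0 D)) (vertex-room zero)
  room₁ : ∣ ∅ {D} ∣ ℕ.+ X zero ℕ.≤ D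
  room₁ = ℕP.≤-trans (ℕP.m≤m+n _ _) room₂

-- Points of Q as averages of colour classes

Clears : ℕ → ℚ → Set
Clears D q = Σ[ N ∈ ℕ ] q * fromℕ D ≡ fromℕ N

clears-multiple : ∀ D K q → Clears D q → Clears (D ℕ.* K) q
clears-multiple D K q (N , qD≡N) = N ℕ.* K , (begin
  q * fromℕ (D ℕ.* K)          ≡⟨ cong (q *_) (fromℕ-* D K) ⟩
  q * (fromℕ D * fromℕ K)      ≡⟨ ℚP.*-assoc q (fromℕ D) (fromℕ K) ⟨
  q * fromℕ D * fromℕ K        ≡⟨ cong (_* fromℕ K) qD≡N ⟩
  fromℕ N * fromℕ K            ≡⟨ fromℕ-* N K ⟨
  fromℕ (N ℕ.* K)              ∎)
  where open ≡-Reasoning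

common-denominator : ∀ {k} (q : Fin k → ℚ) → (∀ i → 0ℚ ≤ q i) →
  Σ[ d ∈ ℕ ] (∀ i → Clears (suc d) (q i))
common-denominator {zero} q _ = 0 , λ ()
common-denominator {suc k} q q≥0 with d , clears ← common-denominator (q ∘ suc) (q≥0 ∘ suc) =
  _ , λ where
    zero → clears-multiple (↧ₙ q zero) (suc d) (q zero) (ℤ.∣ ↥ q zero ∣ , *-denominator (q zero) (q≥0 zero))
    (suc i) → subst (λ D → Clears D (q (suc i))) (ℕP.*-comm (suc d) (↧ₙ q zero))
                    (clears-multiple (suc d) (↧ₙ q zero) (q (suc i)) (clears i))

scaled-≤ : ∀ {q} D {N} → q ≤ 1ℚ → q * fromℕ D ≡ fromℕ N → N ℕ.≤ D
scaled-≤ {q} D {N} q≤1 qD≡N = fromℕ-cancel-≤ (begin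
  fromℕ N        ≡⟨ qD≡N ⟨
  q * fromℕ D    ≤⟨ ℚP.*-monoʳ-≤-nonNeg (fromℕ D) q≤1 ⟩
  1ℚ * fromℕ D   ≡⟨ ℚP.*-identityˡ (fromℕ D) ⟩
  fromℕ D        ∎)
  where open ℚP.≤-Reasoning

module _ {n m} (ends : Ends n m) {x : Fin n → ℚ} {y : Fin m → ℚ} {X : Fin n → ℕ} {Y : Fin m → ℕ}
  {c : ℚ}
  (x≡ : ∀ v → x v * c ≡ fromℕ (X v)) (y≡ : ∀ e → y e * c ≡ fromℕ (Y e)) where

  open ≡-Reasoning

  vertexLoad-scaled : ∀ v → vertexLoad ends x y v * c ≡ fromℕ (X v ℕ.+ degree ends Y v)
  vertexLoad-scaled v = begin
    (x v + sum y-at-v) * c                   ≡⟨ ℚP.*-distribʳ-+ c (x v) (sum y-at-v) ⟩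
    x v * c + sum y-at-v * c                 ≡⟨ cong₂ _+_ (x≡ v) (*-distribʳ-sum c y-at-v) ⟩
    fromℕ (X v) + sum (λ e → y-at-v e * c)   ≡⟨ cong (fromℕ (X v) +_) (sum-cong-≗ scaled) ⟩
    fromℕ (X v) + sum (fromℕ ∘ Y-at-v)       ≡⟨ cong (fromℕ (X v) +_) (fromℕ-sumℕ Y-at-v) ⟨
    fromℕ (X v) + fromℕ (degree ends Y v)    ≡⟨ fromℕ-+ (X v) (degree ends Y v) ⟨
    fromℕ (X v ℕ.+ degree ends Y v)          ∎
    where
    y-at-v : Fin m → ℚ
    y-at-v e = if incident? ends v e then y e else 0ℚ

    Y-at-v : Fin m → ℕ
    Y-at-v e = if incident? ends v e then Y e else 0

    scaled : ∀ e → y-at-v e * c ≡ fromℕ (Y-at-v e)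
    scaled e with incident? ends v e
    ... | true = y≡ e
    ... | false = ℚP.*-zeroˡ c

  edgeLoad-scaled : ∀ e →
    edgeLoad ends x y e * c ≡ fromℕ (X (proj₁ (ends e)) ℕ.+ X (proj₂ (ends e)) ℕ.+ Y e)
  edgeLoad-scaled e = begin
    (x p + x q + y e) * c          ≡⟨ ℚP.*-distribʳ-+ c (x p + x q) (y e) ⟩
    (x p + x q) * c + y e * c      ≡⟨ cong (_+ y e * c) (ℚP.*-distribʳ-+ c (x p) (x q)) ⟩
    x p * c + x q * c + y e * c    ≡⟨ cong₂ _+_ (cong₂ _+_ (x≡ p) (x≡ q)) (y≡ e) ⟩
    fromℕ (X p) + fromℕ (X q) + fromℕ (Y e)  ≡⟨ cong (_+ fromℕ (Y e)) (fromℕ-+ (X p) (X q)) ⟨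
    fromℕ (X p ℕ.+ X q) + fromℕ (Y e)        ≡⟨ fromℕ-+ (X p ℕ.+ X q) (Y e) ⟨
    fromℕ (X p ℕ.+ X q ℕ.+ Y e)              ∎
    where
    p = proj₁ (ends e)
    q = proj₂ (ends e)

scaled-feasible : ∀ {n m} (ends : Ends n m) {x y} → InQ ends x y → ∀ {D}
  (cx : ∀ v → Clears D (x v)) (cy : ∀ e → Clears D (y e)) →
  Feasible D ends (proj₁ ∘ cx) (proj₁ ∘ cy)
scaled-feasible ends {x} {y} (vertex , edge , _) {D} cx cy = record
  { vertex-room = λ v → scaled-≤ D (vertex′ v) (vertexLoad-scaled ends {x} {y} (proj₂ ∘ cx) (proj₂ ∘ cy) v)
  ; edge-room = λ e → scaled-≤ D (edge e) (edgeLoad-scaled ends {x} {y} (proj₂ ∘ cx) (proj₂ ∘ cy) e)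
  }
  where
  vertex′ : ∀ v → vertexLoad ends x y v ≤ 1ℚ
  vertex′ v = subst (_≤ 1ℚ) (cong (x v +_) (Σ≡sum (λ e → if incident? ends v e then y e else 0ℚ))) (vertex v)

sum-χ-lookup : ∀ {d} (S : Subset d) → sum (λ i → χ (lookup S i)) ≡ fromℕ ∣ S ∣
sum-χ-lookup [] = refl
sum-χ-lookup (outside ∷ S) = trans (ℚP.+-identityˡ _) (sum-χ-lookup S)
sum-χ-lookup (inside ∷ S) = trans (cong (1ℚ +_) (sum-χ-lookup S)) (sym (fromℕ-+ 1 ∣ S ∣))

colouring⇒InPT : ∀ {d n m} {ends : Ends n m} {x y}
  (cx : ∀ v → Clears (suc d) (x v)) (cy : ∀ e → Clears (suc d) (y e)) →
  TotalColouring (suc d) ends (proj₁ ∘ cx) (proj₁ ∘ cy) → InPT ends x y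
colouring⇒InPT {d} {ends = ends} {x} {y} cx cy col =
  D , (λ _ → w) , a , b , matching , (λ _ → ℚP.nonNegative⁻¹ w) , Σw≡1 ,
  (λ v → average (x v) (vertexColours col v) (trans (proj₂ (cx v)) (cong fromℕ (sym (∣vertexColours∣ col v))))) ,
  (λ e → average (y e) (edgeColours col e) (trans (proj₂ (cy e)) (cong fromℕ (sym (∣edgeColours∣ col e)))))
  where
  D : ℕ
  D = suc d

  w : ℚ
  w = 1/ fromℕ D

  a : Fin D → Fin _ → Bool
  a i v = lookup (vertexColours col v) i

  b : Fin D → Fin _ → Bool
  b i e = lookup (edgeColours col e) i

  member : ∀ {S : Subset D} {i} → T (lookup S i) → i Sub.∈ S
  member {S} {i} = lookup⇒[]= i S ∘ Equivalence.to T-≡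

  matching : ∀ i → IsTotalMatching ends (a i) (b i)
  matching i =
    (λ u v i∈u i∈v (e , uv) → Disjoint-∉ (u#v uv (vertex-vertex col e)) (member i∈u) (member i∈v)) ,
    (λ e f i∈e i∈f e≢f v v∈e v∈f → Disjoint-∉ (edge-edge col e≢f v∈e v∈f) (member i∈e) (member i∈f)) ,
    (λ v e i∈v i∈e v∈e → Disjoint-∉ (vertex-edge col v∈e) (member i∈v) (member i∈e))
    where
    u#v : ∀ {e u v} → Joins ends e u v →
      Disjoint (vertexColours col (proj₁ (ends e))) (vertexColours col (proj₂ (ends e))) →
      Disjoint (vertexColours col u) (vertexColours col v)
    u#v = Joins-endpoints⁻ ends (λ u v → Disjoint (vertexColours col u) (vertexColours col v)) Disjoint-sym

  open ≡-Reasoning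

  Σw≡1 : Σ[ (λ (_ : Fin D) → w) ] ≡ 1ℚ
  Σw≡1 = begin
    Σ[ (λ (_ : Fin D) → w) ]   ≡⟨ Σ≡sum (λ (_ : Fin D) → w) ⟩
    sum (λ (_ : Fin D) → w)    ≡⟨ sum-const D w ⟩
    fromℕ D * w                ≡⟨ ℚP.*-inverseʳ (fromℕ D) ⟩
    1ℚ                         ∎

  average : ∀ z (S : Subset D) → z * fromℕ D ≡ fromℕ ∣ S ∣ → z ≡ Σ[ (λ i → w * χ (lookup S i)) ]
  average z S zD≡∣S∣ = begin
    z                                   ≡⟨ ℚP.*-identityʳ z ⟨
    z * 1ℚ                              ≡⟨ cong (z *_) (ℚP.*-inverseʳ (fromℕ D)) ⟨
    z * (fromℕ D * w)                   ≡⟨ ℚP.*-assoc z (fromℕ D) w ⟨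
    z * fromℕ D * w                     ≡⟨ cong (_* w) (trans zD≡∣S∣ (sym (sum-χ-lookup S))) ⟩
    sum (λ i → χ (lookup S i)) * w      ≡⟨ ℚP.*-comm (sum (λ i → χ (lookup S i))) w ⟩
    w * sum (λ i → χ (lookup S i))      ≡⟨ *-distribˡ-sum w (λ i → χ (lookup S i)) ⟩
    sum (λ i → w * χ (lookup S i))      ≡⟨ Σ≡sum (λ i → w * χ (lookup S i)) ⟨
    Σ[ (λ i → w * χ (lookup S i)) ]     ∎

Q⊆PT : ∀ {n m} (ends : Ends n m) → IsSimple ends → Acyclic ends →
  ∀ {x y} → InQ ends x y → InPT ends x y
Q⊆PT ends simple acyclic {x} {y} inq@(_ , _ , x≥0 , y≥0) =
  colouring⇒InPT cx cy (forest-colouring ends simple acyclic (scaled-feasible ends inq cx cy))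
  where
  dx = proj₁ (common-denominator x x≥0)
  dy = proj₁ (common-denominator y y≥0)

  cx : ∀ v → Clears (suc dx ℕ.* suc dy) (x v)
  cx v = clears-multiple (suc dx) (suc dy) (x v) (proj₂ (common-denominator x x≥0) v)

  cy : ∀ e → Clears (suc dx ℕ.* suc dy) (y e)
  cy e = subst (λ D → Clears D (y e)) (ℕP.*-comm (suc dy) (suc dx))
               (clears-multiple (suc dy) (suc dx) (y e) (proj₂ (common-denominator y y≥0) e))

mainTheorem1 : ∀ (n m : ℕ) (ends : Ends n m) → IsSimple ends → IsTree ends →
    ∀ (x : Fin n → ℚ) (y : Fin m → ℚ) →
      (InPT ends x y → InQ ends x y) × (InQ ends x y → InPT ends x y)
mainTheorem1 n m ends simple (_ , acyclic) x y = PT⊆Q ends , Q⊆PT ends simple acyclic
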